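{- Let $D=\{w\in\{0,1\}^*\mid |w|_0=|w|_1 \text{ and for all } i\in[|w|]:\ |w[1..i]|_0\leq |w[1..i]|_1\}$ and let $L_{\mathcal{D}}=D\cup\{\widetilde w\mid w\in D\}$. Then $\mathcal{G}_{L_{\mathcal{D}}}$ is exactly the class of comparability graphs.
   Context: All graphs are finite, simple, undirected, with nonempty vertex sets, and graph classes are considered up to isomorphism. $|w|_a$ is the number of occurrences of letter $a$ in $w$, $w[1..i]$ the prefix of length $i$, and $\widetilde w$ is obtained from $w$ by exchanging 0 and 1. A graph $(V,E)$ is a comparability graph if there is a strict partial order $\prec$ on $V$ such that $\{u,v\}\in E$ iff $u\prec v$ or $v\prec u$. For an alphabet $V$ and distinct $u,v\in V$, $h_{u,v}:V^*\to\{0,1\}^*$ is the monoid morphism with $u\mapsto 0$, $v\mapsto 1$ and $x\mapsto\lambda$ (empty word) for all other letters $x$. For a language $L\subseteq\{0,1\}^*$ closed under exchanging 0 and 1 and a nonempty word $w$ whose set of occurring letters is $V$, $G(L,w)$ is the graph with vertex set $V$ in which distinct $u,v$ are adjacent iff $h_{u,v}(w)\in L$. $\mathcal{G}_L$ is the class of all graphs isomorphic to some $G(L,w)$. -}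

module Defs where

open import Data.Nat using (ℕ; zero; suc; _≤_)
open import Data.Bool using (Bool; true; false; not)
open import Data.Fin using (Fin; _≟_)
open import Data.List using (List; []; _∷_; length; take; map)
open import Data.List.Membership.Propositional using (_∈_)
open import Data.Product using (Σ; _×_; _,_; ∃)
open import Data.Sum using (_⊎_)
open import Relation.Nullary using (¬_; yes; no)
open import Relation.Binary.PropositionalEquality using (_≡_)
open import Relation.Binary.Core using (Rel)
open import Relation.Binary.Structures using (IsStrictPartialOrder)
open import Function.Bundles using (_⇔_; _⤖_; Bijection)
open import Level using (0ℓ)

-- Binary words: letter 0 is 'false', letter 1 is 'true'.
Word₂ : Set
Word₂ = List Bool

count : Bool → Word₂ → ℕ
count a [] = 0
count a (b ∷ w) with a Data.Bool.≟ b
... | yes _ = suc (count a w)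
... | no  _ = count a w

swap01 : Word₂ → Word₂
swap01 = map not

Language : Set₁
Language = Word₂ → Set

D : Language
D w = (count false w ≡ count true w)
    × (∀ (i : ℕ) → 1 ≤ i → i ≤ length w → count false (take i w) ≤ count true (take i w))

L-D : Language
L-D w = D w ⊎ Σ Word₂ (λ v → D v × w ≡ swap01 v)

record Graph : Set where
  field
    k      : ℕ
    adj    : Fin (suc k) → Fin (suc k) → Bool
    sym    : ∀ u v → adj u v ≡ adj v u
    irrefl : ∀ u → adj u u ≡ false

  V : Set
  V = Fin (suc k)

open Graph public

h : ∀ {m} → Fin m → Fin m → List (Fin m) → Word₂
h u v [] = []
h u v (x ∷ w) with x ≟ u | x ≟ v
... | yes _ | _     = false ∷ h u v w
... | no _  | yes _ = true ∷ h u v w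
... | no _  | no _  = h u v w

GAdj : (L : Language) → ∀ {m} → List (Fin m) → Fin m → Fin m → Set
GAdj L w u v = ¬ (u ≡ v) × L (h u v w)

SwapClosed : Language → Set
SwapClosed L = ∀ w → L w → L (swap01 w)

IsoToGL : Language → Graph → Set
IsoToGL L G =
  Σ ℕ λ m → Σ (List (Fin m)) λ w →
    (¬ (w ≡ [])) × (∀ (x : Fin m) → x ∈ w) ×
    Σ (Fin (suc (k G)) ⤖ Fin m) λ f →
      ∀ u v → (adj G u v ≡ true) ⇔ GAdj L w (Bijection.to f u) (Bijection.to f v)

InClassGL : Language → Graph → Set
InClassGL L G = IsoToGL L G

IsComparability : Graph → Set₁
IsComparability G =
  Σ (Rel (Fin (suc (k G))) 0ℓ) λ _≺_ →
    IsStrictPartialOrder _≡_ _≺_ ×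
    (∀ u v → (adj G u v ≡ true) ⇔ (u ≺ v ⊎ v ≺ u))

{-# OPTIONS --safe #-}
-- A word w over the vertices induces the relation "h_{u,v}(w) ∈ D": u and v occur equally
-- often and no prefix has more u's than v's. It is transitive, and when every letter occurs it
-- is antisymmetric: mutual domination makes the counts agree on every prefix, so no position
-- can hold u unless u = v.
-- As h_{v,u}(w) is h_{u,v}(w) with 0 and 1 exchanged, G(L_D, w) is the comparability graph of
-- this order restricted to distinct letters.
-- Conversely, given a strict order ≺ on the vertices, concatenate, over all vertices y, a
-- linear extension of the reverse of ≺ that lists the elements ≽ y first. Each block holds
-- every vertex once, so for u ≺ v each block, hence the word, is balanced and dominated. If
-- u ⊀ v and u ≠ v, then in the block of y = u all u's precede all v's, which breaks domination.
module Submission where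

open import Defs hiding (sym; irrefl)
open import Data.Bool using (Bool; true; false)
open import Data.Bool.Properties using (not-involutive)
open import Data.Fin as Fin using (Fin)
open import Data.List using (List; []; _∷_; _++_; [_]; length; take; drop; filter; concatMap; allFin)
open import Data.List.Properties using (∷-injective; ++-assoc; ++-identityʳ; take++drop≡id; length-++-≤ˡ; length-filter; length-tabulate)
open import Data.List.Membership.Propositional using (_∈_; _∉_)
open import Data.List.Membership.Propositional.Properties using (∈-allFin; ∈-filter⁺; ∈-filter⁻; ∈-map⁺; ∈-concat⁺′)
import Data.List.Relation.Unary.All as All
open import Data.List.Relation.Unary.AllPairs using (_∷_)
open import Data.List.Relation.Unary.All.Properties using (All¬⇒¬Any)
open import Data.List.Relation.Unary.Any using (here; there)
open import Data.List.Relation.Unary.Any.Properties using (¬Any[])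
open import Data.List.Relation.Unary.Unique.Propositional using (Unique)
open import Data.List.Relation.Unary.Unique.Propositional.Properties using (allFin⁺; filter⁺)
open import Data.Nat as ℕ using (ℕ; zero; suc; _+_; _≤_; _<_; z≤n; s≤s)
open import Data.Nat.Properties
open import Data.Product using (∃-syntax; _×_; _,_; proj₁; proj₂)
open import Data.Sum as Sum using (_⊎_; inj₁; inj₂)
open import Data.Sum.Function.Propositional using (_⊎-⇔_)
open import Function.Base using (id; _on_; _∘′_)
open import Function.Bundles using (_⇔_; mk⇔; Equivalence; Bijection)
open import Function.Construct.Composition using (_⇔-∘_)
open import Function.Construct.Identity using (⤖-id)
open import Function.Properties.Equivalence as ⇔ using ()
open import Level using (0ℓ)
open import Relation.Binary.Core using (Rel)
open import Relation.Binary.Definitions using (Decidable; DecidableEquality)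
open import Relation.Binary.PropositionalEquality using (_≡_; _≢_; refl; sym; trans; cong; cong₂; subst; isEquivalence; module ≡-Reasoning)
open import Relation.Binary.Structures using (IsStrictPartialOrder)
import Relation.Binary.Construct.StrictToNonStrict as StrictToNonStrict
open import Relation.Nullary using (¬_; yes; no; contradiction)
open import Relation.Unary as U using (Pred; _⊆_)

++≡++-split : ∀ {A : Set} (s t p q : List A) → s ++ t ≡ p ++ q →
  (∃[ m ] p ≡ s ++ m × t ≡ m ++ q) ⊎ (∃[ m ] s ≡ p ++ m × q ≡ m ++ t)
++≡++-split []      t p       q eq = inj₁ (p , refl , eq)
++≡++-split (x ∷ s) t []      q eq = inj₂ (x ∷ s , refl , sym eq)
++≡++-split (x ∷ s) t (y ∷ p) q eq with refl , eq′ ← ∷-injective eq with ++≡++-split s t p q eq′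
... | inj₁ (m , p≡sm , t≡mq) = inj₁ (m , cong (x ∷_) p≡sm , t≡mq)
... | inj₂ (m , s≡pm , q≡mt) = inj₂ (m , cong (x ∷_) s≡pm , q≡mt)

take-length-++ : ∀ {A : Set} (s t : List A) → take (length s) (s ++ t) ≡ s
take-length-++ []      t = refl
take-length-++ (x ∷ s) t = cong (x ∷_) (take-length-++ s t)

module _ {A : Set} {P Q : Pred A 0ℓ} (P? : U.Decidable P) (Q? : U.Decidable Q) (P⊆Q : P ⊆ Q) where

  length-filter-mono : ∀ xs → length (filter P? xs) ≤ length (filter Q? xs)
  length-filter-mono [] = z≤n
  length-filter-mono (x ∷ xs) with P? x | Q? x
  ... | yes _  | yes _  = s≤s (length-filter-mono xs)
  ... | yes px | no ¬qx = contradiction (P⊆Q px) ¬qx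
  ... | no _   | yes _  = m≤n⇒m≤1+n (length-filter-mono xs)
  ... | no _   | no _   = length-filter-mono xs

  length-filter-< : ∀ {e xs} → e ∈ xs → Q e → ¬ P e → length (filter P? xs) < length (filter Q? xs)
  length-filter-< {xs = x ∷ xs} (here refl) qe ¬pe with P? x | Q? x
  ... | yes pe | _      = contradiction pe ¬pe
  ... | no _   | yes _  = s≤s (length-filter-mono xs)
  ... | no _   | no ¬qe = contradiction qe ¬qe
  length-filter-< {xs = x ∷ xs} (there e∈xs) qe ¬pe with P? x | Q? x
  ... | yes _  | yes _  = s≤s (length-filter-< e∈xs qe ¬pe)
  ... | yes px | no ¬qx = contradiction (P⊆Q px) ¬qx
  ... | no _   | yes _  = m≤n⇒m≤1+n (length-filter-< e∈xs qe ¬pe)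
  ... | no _   | no _   = length-filter-< e∈xs qe ¬pe

module Words {A : Set} (_≟_ : DecidableEquality A) where

  occ : A → List A → ℕ
  occ a [] = 0
  occ a (x ∷ w) with x ≟ a
  ... | yes _ = suc (occ a w)
  ... | no  _ = occ a w

  occ-∷-≡ : ∀ a w → occ a (a ∷ w) ≡ suc (occ a w)
  occ-∷-≡ a w with a ≟ a
  ... | yes _   = refl
  ... | no  a≢a = contradiction refl a≢a

  occ-∷-≢ : ∀ {x a} → x ≢ a → ∀ w → occ a (x ∷ w) ≡ occ a w
  occ-∷-≢ {x} {a} x≢a w with x ≟ a
  ... | yes x≡a = contradiction x≡a x≢a
  ... | no  _   = refl

  occ-++ : ∀ a p q → occ a (p ++ q) ≡ occ a p + occ a q
  occ-++ a []      q = refl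
  occ-++ a (x ∷ p) q with x ≟ a
  ... | yes _ = cong suc (occ-++ a p q)
  ... | no  _ = occ-++ a p q

  occ-++-≤ : ∀ a p q → occ a p ≤ occ a (p ++ q)
  occ-++-≤ a p q = ≤-trans (m≤m+n (occ a p) (occ a q)) (≤-reflexive (sym (occ-++ a p q)))

  ∉⇒occ≡0 : ∀ {a w} → a ∉ w → occ a w ≡ 0
  ∉⇒occ≡0 {a} {[]}    _   = refl
  ∉⇒occ≡0 {a} {x ∷ w} a∉w with x ≟ a
  ... | yes refl = contradiction (here refl) a∉w
  ... | no  _    = ∉⇒occ≡0 (λ a∈w → a∉w (there a∈w))

  0<occ⇒∈ : ∀ {a w} → 0 < occ a w → a ∈ w
  0<occ⇒∈ {a} {x ∷ w} 0<occ with x ≟ a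
  ... | yes refl = here refl
  ... | no  _    = there (0<occ⇒∈ 0<occ)

  occ-unique : ∀ {a w} → Unique w → a ∈ w → occ a w ≡ 1
  occ-unique {a} {a ∷ w} (a∉w ∷ _) (here refl) = trans (occ-∷-≡ a w) (cong suc (∉⇒occ≡0 (All¬⇒¬Any a∉w)))
  occ-unique {a} {x ∷ w} (x∉w ∷ w!) (there a∈w) = trans (occ-∷-≢ (All.lookup x∉w a∈w) w) (occ-unique w! a∈w)

  Dominated : A → A → List A → Set
  Dominated a b w = ∀ s t → s ++ t ≡ w → occ a s ≤ occ b s

  Dyck : A → A → List A → Set
  Dyck a b w = Dominated a b w × occ a w ≡ occ b w

  AllBefore : A → A → List A → Set
  AllBefore a b w = ∃[ p ] ∃[ q ] p ++ q ≡ w × occ b p ≡ 0 × occ a q ≡ 0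

  Dominated-[] : ∀ {a b} → Dominated a b []
  Dominated-[] []      _ _  = z≤n
  Dominated-[] (_ ∷ _) _ ()

  Dominated-++ : ∀ {a b p q} → Dominated a b p → Dominated a b q → Dominated a b (p ++ q)
  Dominated-++ {a} {b} {p} {q} a≼p a≼q s t s++t≡p++q with ++≡++-split s t p q s++t≡p++q
  ... | inj₁ (m , p≡s++m , _) = a≼p s m (sym p≡s++m)
  ... | inj₂ (m , refl , q≡m++t) = begin
    occ a (p ++ m)    ≡⟨ occ-++ a p m ⟩
    occ a p + occ a m ≤⟨ +-mono-≤ (a≼p p [] (++-identityʳ p)) (a≼q m t (sym q≡m++t)) ⟩
    occ b p + occ b m ≡⟨ occ-++ b p m ⟨
    occ b (p ++ m)    ∎
    where open ≤-Reasoning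

  Dominated-++⁻ˡ : ∀ {a b} p q → Dominated a b (p ++ q) → Dominated a b p
  Dominated-++⁻ˡ p q a≼pq s t s++t≡p = a≼pq s (t ++ q) (trans (sym (++-assoc s t q)) (cong (_++ q) s++t≡p))

  Dominated-++⁻ʳ : ∀ {a b} p q → occ a p ≡ occ b p → Dominated a b (p ++ q) → Dominated a b q
  Dominated-++⁻ʳ {a} {b} p q balanced a≼pq s t s++t≡q = +-cancelˡ-≤ (occ a p) _ _ (begin
    occ a p + occ a s ≡⟨ occ-++ a p s ⟨
    occ a (p ++ s)    ≤⟨ a≼pq (p ++ s) t (trans (++-assoc p s t) (cong (p ++_) s++t≡q)) ⟩
    occ b (p ++ s)    ≡⟨ occ-++ b p s ⟩
    occ b p + occ b s ≡⟨ cong (_+ occ b s) balanced ⟨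
    occ a p + occ b s ∎)
    where open ≤-Reasoning

  Dominated-antisym : ∀ {a b w} → a ∈ w → Dominated a b w → Dominated b a w → a ≡ b
  Dominated-antisym {a} {b} {a ∷ w} (here refl) a≼w b≼w with a ≟ b
  ... | yes a≡b = a≡b
  ... | no  a≢b = contradiction 1≤0 λ ()
    where
    1≤0 : 1 ≤ 0
    1≤0 = begin
      1           ≡⟨ occ-∷-≡ a [] ⟨
      occ a [ a ] ≤⟨ a≼w [ a ] w refl ⟩
      occ b [ a ] ≡⟨ occ-∷-≢ a≢b [] ⟩
      0           ∎
      where open ≤-Reasoning
  Dominated-antisym {a} {b} {x ∷ w} (there a∈w) a≼w b≼w =
    Dominated-antisym a∈w (Dominated-++⁻ʳ [ x ] w balanced a≼w) (Dominated-++⁻ʳ [ x ] w (sym balanced) b≼w)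
    where
    balanced : occ a [ x ] ≡ occ b [ x ]
    balanced = ≤-antisym (a≼w [ x ] w refl) (b≼w [ x ] w refl)

  Dyck-trans : ∀ {a b c w} → Dyck a b w → Dyck b c w → Dyck a c w
  Dyck-trans (a≼b , a≡b) (b≼c , b≡c) = (λ s t eq → ≤-trans (a≼b s t eq) (b≼c s t eq)) , trans a≡b b≡c

  Dyck-++ : ∀ {a b p q} → Dyck a b p → Dyck a b q → Dyck a b (p ++ q)
  Dyck-++ {a} {b} {p} {q} (a≼p , p-balanced) (a≼q , q-balanced) =
    Dominated-++ a≼p a≼q , (begin
      occ a (p ++ q)    ≡⟨ occ-++ a p q ⟩
      occ a p + occ a q ≡⟨ cong₂ _+_ p-balanced q-balanced ⟩
      occ b p + occ b q ≡⟨ occ-++ b p q ⟨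
      occ b (p ++ q)    ∎)
    where open ≡-Reasoning

  Dyck-concatMap : ∀ {B : Set} {a b} (f : B → List A) → (∀ y → Dyck a b (f y)) → ∀ ys → Dyck a b (concatMap f ys)
  Dyck-concatMap f dyck []       = Dominated-[] , refl
  Dyck-concatMap f dyck (y ∷ ys) = Dyck-++ (dyck y) (Dyck-concatMap f dyck ys)

  Dominated-concatMap⁻ : ∀ {B : Set} {a b} (f : B → List A) → (∀ y → occ a (f y) ≡ occ b (f y)) →
    ∀ {y ys} → y ∈ ys → Dominated a b (concatMap f ys) → Dominated a b (f y)
  Dominated-concatMap⁻ f balanced {ys = y ∷ ys} (here refl) = Dominated-++⁻ˡ (f y) (concatMap f ys)
  Dominated-concatMap⁻ f balanced {ys = z ∷ ys} (there y∈ys) =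
    Dominated-concatMap⁻ f balanced y∈ys ∘′ Dominated-++⁻ʳ (f z) (concatMap f ys) (balanced z)

  AllBefore⇒Dominated : ∀ {a b w} → AllBefore b a w → occ a w ≡ occ b w → Dominated a b w
  AllBefore⇒Dominated {a} {b} (p , q , refl , a∉p , b∉q) balanced s t s++t≡p++q with ++≡++-split s t p q s++t≡p++q
  ... | inj₁ (m , refl , _) = begin
    occ a s        ≤⟨ occ-++-≤ a s m ⟩
    occ a (s ++ m) ≡⟨ a∉p ⟩
    0              ≤⟨ z≤n ⟩
    occ b s        ∎
    where open ≤-Reasoning
  ... | inj₂ (m , refl , refl) = begin
    occ a (p ++ m)           ≡⟨ occ-++ a p m ⟩
    occ a p + occ a m        ≤⟨ +-monoʳ-≤ (occ a p) (occ-++-≤ a m t) ⟩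
    occ a p + occ a (m ++ t) ≡⟨ occ-++ a p (m ++ t) ⟨
    occ a (p ++ m ++ t)      ≡⟨ balanced ⟩
    occ b (p ++ m ++ t)      ≡⟨ occ-++ b p (m ++ t) ⟩
    occ b p + occ b (m ++ t) ≡⟨ cong (occ b p +_) b∉q ⟩
    occ b p + 0              ≤⟨ +-monoʳ-≤ (occ b p) z≤n ⟩
    occ b p + occ b m        ≡⟨ occ-++ b p m ⟨
    occ b (p ++ m)           ∎
    where open ≤-Reasoning

  AllBefore⇒¬Dominated : ∀ {a b w} → AllBefore a b w → 0 < occ a w → ¬ Dominated a b w
  AllBefore⇒¬Dominated {a} {b} (p , q , refl , b∉p , a∉q) 0<occ a≼w = <⇒≱ 0<occ (begin
    occ a (p ++ q)    ≡⟨ occ-++ a p q ⟩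
    occ a p + occ a q ≡⟨ cong (occ a p +_) a∉q ⟩
    occ a p + 0       ≡⟨ +-identityʳ (occ a p) ⟩
    occ a p           ≤⟨ a≼w p q refl ⟩
    occ b p           ≡⟨ b∉p ⟩
    0                 ∎)
    where open ≤-Reasoning

open module FinWords {m : ℕ} = Words (Fin._≟_ {m})

module _ {m : ℕ} (u v : Fin m) where

  h-∷-≡ˡ : ∀ {x} → x ≡ u → ∀ w → h u v (x ∷ w) ≡ false ∷ h u v w
  h-∷-≡ˡ {x} x≡u w with x Fin.≟ u
  ... | yes _   = refl
  ... | no  x≢u = contradiction x≡u x≢u

  h-∷-≡ʳ : ∀ {x} → x ≢ u → x ≡ v → ∀ w → h u v (x ∷ w) ≡ true ∷ h u v w
  h-∷-≡ʳ {x} x≢u x≡v w with x Fin.≟ u | x Fin.≟ v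
  ... | yes x≡u | _     = contradiction x≡u x≢u
  ... | no  _   | yes _ = refl
  ... | no  _   | no  x≢v = contradiction x≡v x≢v

  h-∷-≢ : ∀ {x} → x ≢ u → x ≢ v → ∀ w → h u v (x ∷ w) ≡ h u v w
  h-∷-≢ {x} x≢u x≢v w with x Fin.≟ u | x Fin.≟ v
  ... | yes x≡u | _       = contradiction x≡u x≢u
  ... | no  _   | yes x≡v = contradiction x≡v x≢v
  ... | no  _   | no  _   = refl

  h-++ : ∀ p q → h u v (p ++ q) ≡ h u v p ++ h u v q
  h-++ []      q = refl
  h-++ (x ∷ p) q with x Fin.≟ u | x Fin.≟ v
  ... | yes _ | _     = cong (false ∷_) (h-++ p q)
  ... | no  _ | yes _ = cong (true ∷_) (h-++ p q)
  ... | no  _ | no  _ = h-++ p q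

  h-prefix : ∀ w s t → s ++ t ≡ h u v w → ∃[ p ] ∃[ r ] p ++ r ≡ w × h u v p ≡ s
  h-prefix w       []      t _  = [] , w , refl , refl
  h-prefix (x ∷ w) (c ∷ s) t eq with x Fin.≟ u | x Fin.≟ v
  ... | yes x≡u | _ with refl , eq′ ← ∷-injective eq with h-prefix w s t eq′
  ...   | p , r , refl , refl = x ∷ p , r , refl , h-∷-≡ˡ x≡u p
  h-prefix (x ∷ w) (c ∷ s) t eq | no x≢u | yes x≡v with refl , eq′ ← ∷-injective eq with h-prefix w s t eq′
  ...   | p , r , refl , refl = x ∷ p , r , refl , h-∷-≡ʳ x≢u x≡v p
  h-prefix (x ∷ w) (c ∷ s) t eq | no x≢u | no x≢v with h-prefix w (c ∷ s) t eq
  ...   | p , r , refl , hp≡cs = x ∷ p , r , refl , trans (h-∷-≢ x≢u x≢v p) hp≡cs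

  count-false-h : ∀ w → count false (h u v w) ≡ occ u w
  count-false-h []      = refl
  count-false-h (x ∷ w) with x Fin.≟ u | x Fin.≟ v
  ... | yes _ | _     = cong suc (count-false-h w)
  ... | no  _ | yes _ = count-false-h w
  ... | no  _ | no  _ = count-false-h w

  module _ (u≢v : u ≢ v) where

    count-true-h : ∀ w → count true (h u v w) ≡ occ v w
    count-true-h []      = refl
    count-true-h (x ∷ w) with x Fin.≟ u | x Fin.≟ v
    ... | yes refl | yes refl = contradiction refl u≢v
    ... | yes _    | no  _    = count-true-h w
    ... | no  _    | yes _    = cong suc (count-true-h w)
    ... | no  _    | no  _    = count-true-h w

    h-swap : ∀ w → h v u w ≡ swap01 (h u v w)
    h-swap []      = refl
    h-swap (x ∷ w) with x Fin.≟ u | x Fin.≟ v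
    ... | yes refl | yes refl = contradiction refl u≢v
    ... | yes _    | no  _    = cong (true ∷_) (h-swap w)
    ... | no  _    | yes _    = cong (false ∷_) (h-swap w)
    ... | no  _    | no  _    = h-swap w

swap01-involutive : ∀ z → swap01 (swap01 z) ≡ z
swap01-involutive []      = refl
swap01-involutive (b ∷ z) = cong₂ _∷_ (not-involutive b) (swap01-involutive z)

D⇒prefix-≤ : ∀ {z} → D z → ∀ s t → s ++ t ≡ z → count false s ≤ count true s
D⇒prefix-≤ d []      t _    = z≤n
D⇒prefix-≤ d (x ∷ s) t refl =
  subst (λ r → count false r ≤ count true r) (take-length-++ (x ∷ s) t)
    (proj₂ d (length (x ∷ s)) (s≤s z≤n) (length-++-≤ˡ (x ∷ s)))

D-h⇔Dyck : ∀ {m} {u v : Fin m} → u ≢ v → ∀ w → D (h u v w) ⇔ Dyck u v w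
D-h⇔Dyck {u = u} {v} u≢v w = mk⇔ to from
  where
  counts : ∀ p → (count false (h u v p) ≤ count true (h u v p)) ≡ (occ u p ≤ occ v p)
  counts p = cong₂ _≤_ (count-false-h u v p) (count-true-h u v u≢v p)

  to : D (h u v w) → Dyck u v w
  to d = (λ p r pr≡w → subst id (counts p)
                         (D⇒prefix-≤ d (h u v p) (h u v r) (trans (sym (h-++ u v p r)) (cong (h u v) pr≡w))))
       , trans (sym (count-false-h u v w)) (trans (proj₁ d) (count-true-h u v u≢v w))

  from : Dyck u v w → D (h u v w)
  from (u≼w , balanced) =
    trans (count-false-h u v w) (trans balanced (sym (count-true-h u v u≢v w))) ,
    λ i _ _ → prefix (h-prefix u v w (take i (h u v w)) (drop i (h u v w)) (take++drop≡id i (h u v w)))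
    where
    prefix : ∀ {s} → ∃[ p ] ∃[ r ] p ++ r ≡ w × h u v p ≡ s → count false s ≤ count true s
    prefix (p , r , pr≡w , refl) = subst id (sym (counts p)) (u≼w p r pr≡w)

L-D-h⇔Dyck : ∀ {m} {u v : Fin m} → u ≢ v → ∀ w → L-D (h u v w) ⇔ (Dyck u v w ⊎ Dyck v u w)
L-D-h⇔Dyck {u = u} {v} u≢v w = mk⇔ to from
  where
  v≢u : v ≢ u
  v≢u = u≢v ∘′ sym

  to : L-D (h u v w) → Dyck u v w ⊎ Dyck v u w
  to (inj₁ d)              = inj₁ (Equivalence.to (D-h⇔Dyck u≢v w) d)
  to (inj₂ (z , d , h≡~z)) = inj₂ (Equivalence.to (D-h⇔Dyck v≢u w) (subst D z≡h-vu d))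
    where
    z≡h-vu : z ≡ h v u w
    z≡h-vu = begin
      z                 ≡⟨ swap01-involutive z ⟨
      swap01 (swap01 z) ≡⟨ cong swap01 h≡~z ⟨
      swap01 (h u v w)  ≡⟨ h-swap u v u≢v w ⟨
      h v u w           ∎
      where open ≡-Reasoning

  from : Dyck u v w ⊎ Dyck v u w → L-D (h u v w)
  from (inj₁ d) = inj₁ (Equivalence.from (D-h⇔Dyck u≢v w) d)
  from (inj₂ d) = inj₂ (h v u w , Equivalence.from (D-h⇔Dyck v≢u w) d , h-swap v u v≢u w)

DyckOrder : ∀ {m} → List (Fin m) → Rel (Fin m) 0ℓ
DyckOrder w a b = a ≢ b × Dyck a b w

GAdj-L-D⇔DyckOrder : ∀ {m} (w : List (Fin m)) u v → GAdj L-D w u v ⇔ (DyckOrder w u v ⊎ DyckOrder w v u)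
GAdj-L-D⇔DyckOrder w u v = mk⇔ to from
  where
  to : GAdj L-D w u v → DyckOrder w u v ⊎ DyckOrder w v u
  to (u≢v , l) = Sum.map (u≢v ,_) (u≢v ∘′ sym ,_) (Equivalence.to (L-D-h⇔Dyck u≢v w) l)

  from : DyckOrder w u v ⊎ DyckOrder w v u → GAdj L-D w u v
  from (inj₁ (u≢v , d)) = u≢v , Equivalence.from (L-D-h⇔Dyck u≢v w) (inj₁ d)
  from (inj₂ (v≢u , d)) = v≢u ∘′ sym , Equivalence.from (L-D-h⇔Dyck (v≢u ∘′ sym) w) (inj₂ d)

DyckOrder-isStrictPartialOrder : ∀ {m} {w : List (Fin m)} → (∀ x → x ∈ w) →
  IsStrictPartialOrder _≡_ (DyckOrder w)
DyckOrder-isStrictPartialOrder {w = w} ∈w = record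
  { isEquivalence = isEquivalence
  ; irrefl        = λ { refl (a≢a , _) → a≢a refl }
  ; trans         = λ { {a} (a≢b , a≼b) (b≢c , b≼c) →
                          (λ { refl → a≢b (Dominated-antisym (∈w a) (proj₁ a≼b) (proj₁ b≼c)) })
                        , Dyck-trans a≼b b≼c }
  ; <-resp-≈      = (λ { refl a<b → a<b }) , (λ { refl a<b → a<b })
  }

isStrictPartialOrder-on : ∀ {A B : Set} {_<_ : Rel A 0ℓ} (f : B → A) →
  IsStrictPartialOrder _≡_ _<_ → IsStrictPartialOrder _≡_ (_<_ on f)
isStrictPartialOrder-on f spo = record
  { isEquivalence = isEquivalence
  ; irrefl        = λ { refl → <.irrefl refl }
  ; trans         = <.trans
  ; <-resp-≈      = (λ { refl a<b → a<b }) , (λ { refl a<b → a<b })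
  }
  where module < = IsStrictPartialOrder spo

InClassGL-L-D⇒IsComparability : ∀ G → InClassGL L-D G → IsComparability G
InClassGL-L-D⇒IsComparability G (m , w , _ , ∈w , f , adj⇔GAdj) =
  (DyckOrder w on F) ,
  isStrictPartialOrder-on F (DyckOrder-isStrictPartialOrder ∈w) ,
  λ u v → GAdj-L-D⇔DyckOrder w (F u) (F v) ⇔-∘ adj⇔GAdj u v
  where
  F = Bijection.to f

module _ {n : ℕ} (κ : Fin n → ℕ) where

  keyIs? : ∀ t → U.Decidable (λ x → κ x ≡ t)
  keyIs? t x = κ x ℕ.≟ t

  level : ℕ → List (Fin n)
  level t = filter (keyIs? t) (allFin n)

  descendingByKey : ℕ → List (Fin n)
  descendingByKey zero    = level zero
  descendingByKey (suc t) = level (suc t) ++ descendingByKey t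

  occ-level-≡ : ∀ {x t} → κ x ≡ t → occ x (level t) ≡ 1
  occ-level-≡ {x} {t} κx≡t = occ-unique (filter⁺ (keyIs? t) (allFin⁺ n)) (∈-filter⁺ (keyIs? t) (∈-allFin x) κx≡t)

  occ-level-≢ : ∀ {x t} → κ x ≢ t → occ x (level t) ≡ 0
  occ-level-≢ {x} {t} κx≢t = ∉⇒occ≡0 (κx≢t ∘′ proj₂ ∘′ ∈-filter⁻ (keyIs? t) {xs = allFin n})

  occ-descendingByKey-> : ∀ {x} t → t < κ x → occ x (descendingByKey t) ≡ 0
  occ-descendingByKey-> zero    t<κx = occ-level-≢ (>⇒≢ t<κx)
  occ-descendingByKey-> {x} (suc t) t<κx = trans (occ-++ x (level (suc t)) (descendingByKey t))
    (cong₂ _+_ (occ-level-≢ (>⇒≢ t<κx)) (occ-descendingByKey-> t (<-trans (n<1+n t) t<κx)))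

  occ-descendingByKey-≤ : ∀ {x} t → κ x ≤ t → occ x (descendingByKey t) ≡ 1
  occ-descendingByKey-≤ zero    κx≤0 = occ-level-≡ (n≤0⇒n≡0 κx≤0)
  occ-descendingByKey-≤ {x} (suc t) κx≤t with κ x ℕ.≟ suc t
  ... | yes κx≡t = trans (occ-++ x (level (suc t)) (descendingByKey t))
                     (cong₂ _+_ (occ-level-≡ κx≡t) (occ-descendingByKey-> t (≤-reflexive (sym κx≡t))))
  ... | no  κx≢t = trans (occ-++ x (level (suc t)) (descendingByKey t))
                     (cong₂ _+_ (occ-level-≢ κx≢t) (occ-descendingByKey-≤ t (m<1+n⇒m≤n (≤∧≢⇒< κx≤t κx≢t))))

  descendingByKey-AllBefore : ∀ {a b} → κ a < κ b → ∀ t → κ a ≤ t → AllBefore b a (descendingByKey t)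
  descendingByKey-AllBefore {a} {b} κa<κb t κa≤t with κ a ℕ.≟ t
  ... | yes refl = [] , descendingByKey (κ a) , refl , refl , occ-descendingByKey-> (κ a) κa<κb
  descendingByKey-AllBefore κa<κb zero κa≤0 | no κa≢0 = contradiction (n≤0⇒n≡0 κa≤0) κa≢0
  descendingByKey-AllBefore {a} κa<κb (suc t) κa≤t | no κa≢t
    with p , q , p++q≡ , a∉p , b∉q ← descendingByKey-AllBefore κa<κb t (m<1+n⇒m≤n (≤∧≢⇒< κa≤t κa≢t)) =
    level (suc t) ++ p , q , trans (++-assoc (level (suc t)) p q) (cong (level (suc t) ++_) p++q≡) ,
    trans (occ-++ a (level (suc t)) p) (cong₂ _+_ (occ-level-≢ κa≢t) a∉p) , b∉q

≺-decidable : ∀ {A : Set} {_≺_ : Rel A 0ℓ} (adj : A → A → Bool) → IsStrictPartialOrder _≡_ _≺_ →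
  (∀ u v → (adj u v ≡ true) ⇔ (u ≺ v ⊎ v ≺ u)) → Decidable _≺_
≺-decidable adj spo adj⇔ u v with adj u v in adj≡
... | true with Equivalence.to (adj⇔ u v) adj≡
...   | inj₁ u≺v = yes u≺v
...   | inj₂ v≺u = no (λ u≺v → IsStrictPartialOrder.asym spo u≺v v≺u)
≺-decidable adj spo adj⇔ u v | false =
  no (λ u≺v → contradiction (trans (sym adj≡) (Equivalence.from (adj⇔ u v) (inj₁ u≺v))) λ ())

module DyckWord {n : ℕ} {_≺_ : Rel (Fin n) 0ℓ} (≺-spo : IsStrictPartialOrder _≡_ _≺_) (_≺?_ : Decidable _≺_) where

  open IsStrictPartialOrder ≺-spo using (irrefl; <-respˡ-≈) renaming (trans to ≺-trans)
  open StrictToNonStrict _≡_ _≺_ using () renaming (_≤_ to _≼_; decidable to ≼-decidable; ≤-<-trans to ≼-≺-trans)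

  _≼?_ : Decidable _≼_
  _≼?_ = ≼-decidable Fin._≟_ _≺?_

  rank : Fin n → ℕ
  rank x = length (filter (_≺? x) (allFin n))

  rank-≤ : ∀ x → rank x ≤ n
  rank-≤ x = ≤-trans (length-filter (_≺? x) (allFin n)) (≤-reflexive (length-tabulate id))

  rank-mono : ∀ {u v} → u ≺ v → rank u < rank v
  rank-mono {u} {v} u≺v =
    length-filter-< (_≺? u) (_≺? v) (λ z≺u → ≺-trans z≺u u≺v) (∈-allFin u) u≺v (irrefl refl)

  boost : Fin n → Fin n → ℕ
  boost y x with y ≼? x
  ... | yes _ = suc n
  ... | no  _ = 0

  boost-≼ : ∀ {y x} → y ≼ x → boost y x ≡ suc n
  boost-≼ {y} {x} y≼x with y ≼? x
  ... | yes _   = refl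
  ... | no  y⋠x = contradiction y≼x y⋠x

  boost-⋠ : ∀ {y x} → ¬ y ≼ x → boost y x ≡ 0
  boost-⋠ {y} {x} y⋠x with y ≼? x
  ... | yes y≼x = contradiction y≼x y⋠x
  ... | no  _   = refl

  boost-≤ : ∀ y x → boost y x ≤ suc n
  boost-≤ y x with y ≼? x
  ... | yes _ = ≤-refl
  ... | no  _ = z≤n

  boost-mono : ∀ y {u v} → u ≺ v → boost y u ≤ boost y v
  boost-mono y {u} {v} u≺v with y ≼? v
  ... | yes _   = boost-≤ y u
  ... | no  y⋠v = ≤-reflexive (boost-⋠ (λ y≼u → y⋠v (inj₁ (≼-≺-trans sym ≺-trans <-respˡ-≈ y≼u u≺v))))

  -- Listing by decreasing key y gives a linear extension of the reverse of ≺ with the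
  -- elements ≽ y first: rank is strictly monotone, and the boost exceeds every rank.
  key : Fin n → Fin n → ℕ
  key y x = rank x + boost y x

  maxKey : ℕ
  maxKey = n + suc n

  key-≤ : ∀ y x → key y x ≤ maxKey
  key-≤ y x = +-mono-≤ (rank-≤ x) (boost-≤ y x)

  key-mono : ∀ y {u v} → u ≺ v → key y u < key y v
  key-mono y u≺v = +-mono-<-≤ (rank-mono u≺v) (boost-mono y u≺v)

  key-⊀ : ∀ {u v} → u ≢ v → ¬ u ≺ v → key u v < key u u
  key-⊀ {u} {v} u≢v u⊀v = begin-strict
    rank v + boost u v ≡⟨ cong (rank v +_) (boost-⋠ Sum.[ u⊀v , u≢v ]) ⟩
    rank v + 0         ≡⟨ +-identityʳ (rank v) ⟩
    rank v             ≤⟨ rank-≤ v ⟩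
    n                  <⟨ n<1+n n ⟩
    suc n              ≤⟨ m≤n+m (suc n) (rank u) ⟩
    rank u + suc n     ≡⟨ cong (rank u +_) (boost-≼ (inj₂ refl)) ⟨
    rank u + boost u u ∎
    where open ≤-Reasoning

  block : Fin n → List (Fin n)
  block y = descendingByKey (key y) maxKey

  occ-block : ∀ y x → occ x (block y) ≡ 1
  occ-block y x = occ-descendingByKey-≤ (key y) maxKey (key-≤ y x)

  0<occ-block : ∀ y x → 0 < occ x (block y)
  0<occ-block y x = ≤-reflexive (sym (occ-block y x))

  balanced-block : ∀ y a b → occ a (block y) ≡ occ b (block y)
  balanced-block y a b = trans (occ-block y a) (sym (occ-block y b))

  word : List (Fin n)
  word = concatMap block (allFin n)

  ∈-word : ∀ x → x ∈ word
  ∈-word x = ∈-concat⁺′ (0<occ⇒∈ (0<occ-block x x)) (∈-map⁺ block (∈-allFin x))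

  ≺⇒Dyck : ∀ {u v} → u ≺ v → Dyck u v word
  ≺⇒Dyck {u} {v} u≺v = Dyck-concatMap block Dyck-block (allFin n)
    where
    Dyck-block : ∀ y → Dyck u v (block y)
    Dyck-block y =
      AllBefore⇒Dominated (descendingByKey-AllBefore (key y) (key-mono y u≺v) maxKey (key-≤ y u))
                          (balanced-block y u v) ,
      balanced-block y u v

  Dominated⇒≺ : ∀ {u v} → u ≢ v → Dominated u v word → u ≺ v
  Dominated⇒≺ {u} {v} u≢v u≼v with u ≺? v
  ... | yes u≺v = u≺v
  ... | no  u⊀v = contradiction
    (Dominated-concatMap⁻ block (λ y → balanced-block y u v) (∈-allFin u) u≼v)
    (AllBefore⇒¬Dominated (descendingByKey-AllBefore (key u) (key-⊀ u≢v u⊀v) maxKey (key-≤ u v))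
                          (0<occ-block u u))

  ≺⇔DyckOrder : ∀ {u v} → u ≺ v ⇔ DyckOrder word u v
  ≺⇔DyckOrder = mk⇔ (λ u≺v → (λ { refl → irrefl refl u≺v }) , ≺⇒Dyck u≺v)
                    (λ (u≢v , u≼v , _) → Dominated⇒≺ u≢v u≼v)

IsComparability⇒InClassGL-L-D : ∀ G → IsComparability G → InClassGL L-D G
IsComparability⇒InClassGL-L-D G (_≺_ , ≺-spo , adj⇔) =
  suc (k G) , word , word≢[] , ∈-word , ⤖-id _ ,
  λ u v → ⇔.sym (GAdj-L-D⇔DyckOrder word u v) ⇔-∘ ((≺⇔DyckOrder ⊎-⇔ ≺⇔DyckOrder) ⇔-∘ adj⇔ u v)
  where
  open DyckWord ≺-spo (≺-decidable (adj G) ≺-spo adj⇔)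

  word≢[] : word ≢ []
  word≢[] word≡[] = ¬Any[] (subst (Fin.zero ∈_) word≡[] (∈-word Fin.zero))

mainTheorem13 : ∀ (G : Graph) → (InClassGL L-D G → IsComparability G) × (IsComparability G → InClassGL L-D G)
mainTheorem13 G = InClassGL-L-D⇒IsComparability G , IsComparability⇒InClassGL-L-D G
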